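{- For any matroid $M=([n],I)$, its rank function $\mathrm{rk}_M:2^{[n]}\to\mathbb{R}$ is a strongly 2-coverage set function.
   Context: For $\tau\subseteq[n]$, $f_\tau$ denotes the set function on $[n]\setminus\tau$ given by $f_\tau(T)=f(T\cup\tau)$. A function $g:2^{V}\to\mathbb{R}_{\ge0}$ is a coverage function if there are a finite set $U$, subsets $A_i\subseteq U$ ($i\in V$) and a nonnegative measure $w$ on $U$ with $g(T)=w(\bigcup_{i\in T}A_i)$. A function $f$ is strongly 2-coverage if for every $\tau\subseteq[n]$ with $0\le|\tau|\le n-2$ there is a coverage function $g:2^{[n]\setminus\tau}\to\mathbb{R}$ such that $f_\tau(T)=g(T)+f(\tau)$ for every $T\subseteq[n]\setminus\tau$ with $|T|\in\{1,2\}$. -}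

module Defs where

open import Data.Nat as ℕ using (ℕ; zero; suc; _⊔_; _≤_; _<_)
open import Data.Bool using (Bool; true; false; if_then_else_)
open import Data.Fin using (Fin)
open import Data.Fin.Subset using (Subset; inside; outside; ⊥; ⁅_⁆; _∈_; _∉_; _⊆_; _∪_; _∩_; ∣_∣)
open import Data.Fin.Subset.Properties using (_⊆?_)
open import Data.Vec as Vec using (Vec; []; _∷_)
open import Data.List as List using (List)
open import Data.Product using (Σ; ∃; _×_; _,_)
open import Data.Sum using (_⊎_)
open import Data.Integer using (+_)
open import Data.Rational as ℚ using (ℚ; 0ℚ; _/_)
open import Relation.Nullary using (Dec)
open import Relation.Nullary.Decidable using (_×-dec_)
open import Relation.Unary using (Pred)
open import Relation.Binary.PropositionalEquality using (_≡_)

record Matroid (n : ℕ) : Set₁ where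
  field
    Indep     : Pred (Subset n) _
    indep?    : (S : Subset n) → Dec (Indep S)
    indep-⊥   : Indep ⊥
    indep-⊆   : ∀ {A B} → A ⊆ B → Indep B → Indep A
    exchange  : ∀ {A B} → Indep A → Indep B → ∣ A ∣ < ∣ B ∣ →
                ∃ λ x → x ∈ B × x ∉ A × Indep (A ∪ ⁅ x ⁆)

allSubsets : (n : ℕ) → List (Subset n)
allSubsets zero    = [] List.∷ List.[]
allSubsets (suc n) = List.map (inside ∷_) (allSubsets n) List.++ List.map (outside ∷_) (allSubsets n)

rank : ∀ {n} → Matroid n → Subset n → ℕ
rank {n} M T =
  List.foldr _⊔_ 0
    (List.map ∣_∣ (List.filter (λ S → (S ⊆? T) ×-dec Matroid.indep? M S) (allSubsets n)))

ℕ→ℚ : ℕ → ℚ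
ℕ→ℚ k = + k / 1

measure : ∀ {m} → (Fin m → ℚ) → Subset m → ℚ
measure {m} w S = List.foldr ℚ._+_ 0ℚ
  (List.map (λ u → if Vec.lookup S u then w u else 0ℚ) (List.allFin m))

bigUnion : ∀ {n m} → (Fin n → Subset m) → Subset n → Subset m
bigUnion {n} A T = Vec.foldr (λ _ → Subset _) _∪_ ⊥
  (Vec.zipWith (λ b s → if b then s else ⊥) T (Vec.tabulate A))

record Coverage (n : ℕ) : Set where
  field
    m        : ℕ
    A        : Fin n → Subset m
    w        : Fin m → ℚ
    w-nonneg : ∀ u → 0ℚ ℚ.≤ w u

  eval : Subset n → ℚ
  eval T = measure w (bigUnion A T)

Disjoint : ∀ {n} → Subset n → Subset n → Set
Disjoint {n} S T = S ∩ T ≡ ⊥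

Strongly2Coverage : ∀ {n} → (Subset n → ℚ) → Set
Strongly2Coverage {n} f =
  (τ : Subset n) → ∣ τ ∣ ℕ.+ 2 ≤ n →
  Σ (Coverage n) λ g →
    (T : Subset n) → Disjoint T τ → (∣ T ∣ ≡ 1 ⊎ ∣ T ∣ ≡ 2) →
    f (T ∪ τ) ≡ Coverage.eval g T ℚ.+ f τ

-- Fix τ and put ρ T = rk (T ∪ τ), r₀ = rk τ. By submodularity and monotonicity every
-- element i has ρ ⁅ i ⁆ ∈ {r₀, r₀ + 1}; call i a non-loop in the second case. Two non-loops
-- are parallel when ρ (⁅ i ⁆ ∪ ⁅ j ⁆) = r₀ + 1, and submodularity again makes this an
-- equivalence relation. Sending every non-loop to the one-point set of a canonical member
-- of its parallel class and every loop to ∅ gives, with unit weights, a coverage function g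
-- such that ρ T = g T + r₀ whenever ∣ T ∣ ≤ 2: two non-parallel non-loops raise the rank by
-- 2, while a loop or a parallel partner adds nothing.
module Submission where

open import Defs
open import Data.Nat as ℕ using (ℕ; zero; suc; _+_; _∸_; _⊔_; _≤_; s≤s)
import Data.Nat.Properties as ℕP
open import Data.Bool using (Bool; true; false; if_then_else_; _∨_)
open import Data.Fin using (Fin) renaming (zero to fzero; suc to fsuc)
open import Data.Fin.Subset
open import Data.Fin.Subset.Properties
open import Data.Vec as Vec using (_∷_; []; here; there)
open import Data.List as List using (List; filter; allFin)
open import Data.List.Relation.Unary.Any using () renaming (here to hereₗ; there to thereₗ)
import Data.List.Membership.Propositional as List
import Data.List.Membership.Propositional.Properties as ListMem
import Data.List.Properties as ListP
open import Data.Maybe using (fromMaybe)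
open import Data.Product using (∃; ∃₂; _×_; _,_; proj₂)
open import Data.Sum using (_⊎_; inj₁; inj₂)
open import Data.Empty using (⊥-elim)
open import Function using (_∘_)
open import Data.Integer as ℤ using ()
import Data.Integer.Properties as ℤP
open import Data.Rational as ℚ using (ℚ; mkℚ; 0ℚ; 1ℚ)
import Data.Rational.Properties as ℚP
import Data.Nat.Coprimality as Coprimality
open import Relation.Nullary using (¬_; Dec; yes; no; does)
open import Relation.Nullary.Decidable using (_×-dec_; dec-true; dec-false)
open import Relation.Binary using (Rel; IsPartialEquivalence; Decidable)
open import Level using (0ℓ)
open import Relation.Binary.PropositionalEquality
import Algebra.Solver.IdempotentCommutativeMonoid as ICMSolver

private
  variable
    n m m′ : ℕ

∪-⊆ : {p q r : Subset n} → p ⊆ r → q ⊆ r → p ∪ q ⊆ r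
∪-⊆ {p = p} {q} p⊆r q⊆r x∈p∪q with x∈p∪q⁻ p q x∈p∪q
... | inj₁ x∈p = p⊆r x∈p
... | inj₂ x∈q = q⊆r x∈q

⊆-∩ : {p q r : Subset n} → r ⊆ p → r ⊆ q → r ⊆ p ∩ q
⊆-∩ r⊆p r⊆q x∈r = x∈p∩q⁺ (r⊆p x∈r , r⊆q x∈r)

x∈p⇒⁅x⁆⊆p : {x : Fin n} {p : Subset n} → x ∈ p → ⁅ x ⁆ ⊆ p
x∈p⇒⁅x⁆⊆p {x = x} x∈p y∈⁅x⁆ = subst (_∈ _) (sym (x∈⁅y⁆⇒x≡y x y∈⁅x⁆)) x∈p

∣p∪q∣+∣p∩q∣≡∣p∣+∣q∣ : (p q : Subset n) → ∣ p ∪ q ∣ + ∣ p ∩ q ∣ ≡ ∣ p ∣ + ∣ q ∣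
∣p∪q∣+∣p∩q∣≡∣p∣+∣q∣ []            []            = refl
∣p∪q∣+∣p∩q∣≡∣p∣+∣q∣ (inside ∷ p)  (inside ∷ q)  = cong suc (begin
  ∣ p ∪ q ∣ + suc ∣ p ∩ q ∣  ≡⟨ ℕP.+-suc ∣ p ∪ q ∣ ∣ p ∩ q ∣ ⟩
  suc (∣ p ∪ q ∣ + ∣ p ∩ q ∣) ≡⟨ cong suc (∣p∪q∣+∣p∩q∣≡∣p∣+∣q∣ p q) ⟩
  suc (∣ p ∣ + ∣ q ∣)         ≡⟨ ℕP.+-suc ∣ p ∣ ∣ q ∣ ⟨
  ∣ p ∣ + suc ∣ q ∣           ∎)
  where open ≡-Reasoning
∣p∪q∣+∣p∩q∣≡∣p∣+∣q∣ (inside ∷ p)  (outside ∷ q) = cong suc (∣p∪q∣+∣p∩q∣≡∣p∣+∣q∣ p q)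
∣p∪q∣+∣p∩q∣≡∣p∣+∣q∣ (outside ∷ p) (inside ∷ q)  =
  trans (cong suc (∣p∪q∣+∣p∩q∣≡∣p∣+∣q∣ p q)) (sym (ℕP.+-suc ∣ p ∣ ∣ q ∣))
∣p∪q∣+∣p∩q∣≡∣p∣+∣q∣ (outside ∷ p) (outside ∷ q) = ∣p∪q∣+∣p∩q∣≡∣p∣+∣q∣ p q

x∉p⇒∣p∪⁅x⁆∣≡1+∣p∣ : (p : Subset n) (x : Fin n) → x ∉ p → ∣ p ∪ ⁅ x ⁆ ∣ ≡ suc ∣ p ∣
x∉p⇒∣p∪⁅x⁆∣≡1+∣p∣ (inside ∷ p)  fzero    x∉p = ⊥-elim (x∉p here)
x∉p⇒∣p∪⁅x⁆∣≡1+∣p∣ (outside ∷ p) fzero    x∉p = cong (suc ∘ ∣_∣) (∪-identityʳ p)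
x∉p⇒∣p∪⁅x⁆∣≡1+∣p∣ (inside ∷ p)  (fsuc x) x∉p = cong suc (x∉p⇒∣p∪⁅x⁆∣≡1+∣p∣ p x (x∉p ∘ there))
x∉p⇒∣p∪⁅x⁆∣≡1+∣p∣ (outside ∷ p) (fsuc x) x∉p = x∉p⇒∣p∪⁅x⁆∣≡1+∣p∣ p x (x∉p ∘ there)

∣⁅x⁆∪⁅x⁆∣≡1 : (x : Fin n) → ∣ ⁅ x ⁆ ∪ ⁅ x ⁆ ∣ ≡ 1
∣⁅x⁆∪⁅x⁆∣≡1 x = trans (cong ∣_∣ (∪-idem ⁅ x ⁆)) (∣⁅x⁆∣≡1 x)

x≢y⇒∣⁅x⁆∪⁅y⁆∣≡2 : {x y : Fin n} → x ≢ y → ∣ ⁅ x ⁆ ∪ ⁅ y ⁆ ∣ ≡ 2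
x≢y⇒∣⁅x⁆∪⁅y⁆∣≡2 {x = x} {y} x≢y =
  trans (x∉p⇒∣p∪⁅x⁆∣≡1+∣p∣ ⁅ x ⁆ y (x≢y⇒x∉⁅y⁆ (x≢y ∘ sym))) (cong suc (∣⁅x⁆∣≡1 x))

∣p∣≡0⇒p≡⊥ : (p : Subset n) → ∣ p ∣ ≡ 0 → p ≡ ⊥
∣p∣≡0⇒p≡⊥ []            _   = refl
∣p∣≡0⇒p≡⊥ (outside ∷ p) ∣p∣≡0 = cong (outside ∷_) (∣p∣≡0⇒p≡⊥ p ∣p∣≡0)

∣p∣≡1⇒p≡⁅x⁆ : (p : Subset n) → ∣ p ∣ ≡ 1 → ∃ λ x → p ≡ ⁅ x ⁆
∣p∣≡1⇒p≡⁅x⁆ (inside ∷ p)  ∣p∣≡1 = fzero , cong (inside ∷_) (∣p∣≡0⇒p≡⊥ p (ℕP.suc-injective ∣p∣≡1))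
∣p∣≡1⇒p≡⁅x⁆ (outside ∷ p) ∣p∣≡1 with ∣p∣≡1⇒p≡⁅x⁆ p ∣p∣≡1
... | x , refl = fsuc x , refl

∣p∣≡2⇒p≡⁅x⁆∪⁅y⁆ : (p : Subset n) → ∣ p ∣ ≡ 2 → ∃₂ λ x y → p ≡ ⁅ x ⁆ ∪ ⁅ y ⁆
∣p∣≡2⇒p≡⁅x⁆∪⁅y⁆ (inside ∷ p)  ∣p∣≡2 with ∣p∣≡1⇒p≡⁅x⁆ p (ℕP.suc-injective ∣p∣≡2)
... | y , refl = fzero , fsuc y , cong (inside ∷_) (sym (∪-identityˡ ⁅ y ⁆))
∣p∣≡2⇒p≡⁅x⁆∪⁅y⁆ (outside ∷ p) ∣p∣≡2 with ∣p∣≡2⇒p≡⁅x⁆∪⁅y⁆ p ∣p∣≡2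
... | x , y , refl = fsuc x , fsuc y , refl

bigUnion-⊥ : (A : Fin n → Subset m) → bigUnion A ⊥ ≡ ⊥
bigUnion-⊥ {zero}  A = refl
bigUnion-⊥ {suc n} A = trans (∪-identityˡ _) (bigUnion-⊥ (λ i → A (fsuc i)))

bigUnion-⁅⁆ : (A : Fin n → Subset m) (i : Fin n) → bigUnion A ⁅ i ⁆ ≡ A i
bigUnion-⁅⁆ A fzero    = trans (cong (A fzero ∪_) (bigUnion-⊥ (λ i → A (fsuc i)))) (∪-identityʳ _)
bigUnion-⁅⁆ A (fsuc i) = trans (∪-identityˡ _) (bigUnion-⁅⁆ (λ i → A (fsuc i)) i)

bigUnion-∪ : (A : Fin n → Subset m) (p q : Subset n) →
             bigUnion A (p ∪ q) ≡ bigUnion A p ∪ bigUnion A q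
bigUnion-∪ A []      []      = sym (∪-idem ⊥)
bigUnion-∪ A (b ∷ p) (c ∷ q) = begin
  pick (b ∨ c) ∪ bigUnion A′ (p ∪ q)
    ≡⟨ cong₂ _∪_ (pick-∨ b c) (bigUnion-∪ A′ p q) ⟩
  (pick b ∪ pick c) ∪ (bigUnion A′ p ∪ bigUnion A′ q)
    ≡⟨ interchange (pick b) (pick c) (bigUnion A′ p) (bigUnion A′ q) ⟩
  (pick b ∪ bigUnion A′ p) ∪ (pick c ∪ bigUnion A′ q) ∎
  where
  open ≡-Reasoning
  open ICMSolver (∪-idempotentCommutativeMonoid _)
  A′ : Fin _ → Subset _
  A′ i = A (fsuc i)
  pick : Bool → Subset _
  pick b = if b then A fzero else ⊥
  pick-∨ : ∀ b c → pick (b ∨ c) ≡ pick b ∪ pick c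
  pick-∨ true  true  = sym (∪-idem _)
  pick-∨ true  false = sym (∪-identityʳ _)
  pick-∨ false c     = sym (∪-identityˡ _)
  interchange : ∀ x y u v → (x ∪ y) ∪ (u ∪ v) ≡ (x ∪ u) ∪ (y ∪ v)
  interchange = solve 4 (λ x y u v → (x ⊕ y) ⊕ (u ⊕ v) ⊜ (x ⊕ u) ⊕ (y ⊕ v)) refl

ℕ→ℚ≡mkℚ : ∀ k → ℕ→ℚ k ≡ mkℚ (ℤ.+ k) 0 (Coprimality.sym (Coprimality.1-coprimeTo k))
ℕ→ℚ≡mkℚ k = ℚP.normalize-coprime (Coprimality.sym (Coprimality.1-coprimeTo k))

ℕ→ℚ-homo-+ : ∀ a b → ℕ→ℚ (a + b) ≡ ℕ→ℚ a ℚ.+ ℕ→ℚ b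
ℕ→ℚ-homo-+ a b rewrite ℕ→ℚ≡mkℚ a | ℕ→ℚ≡mkℚ b =
  cong (ℚ._/ 1) (sym (cong₂ ℤ._+_ (ℤP.*-identityʳ (ℤ.+ a)) (ℤP.*-identityʳ (ℤ.+ b))))

measure-unit : (S : Subset m) → measure (λ _ → 1ℚ) S ≡ ℕ→ℚ ∣ S ∣
measure-unit []      = refl
measure-unit (b ∷ S) = begin
  measure (λ _ → 1ℚ) (b ∷ S)         ≡⟨ measure≡sum (b ∷ S) ⟩
  weight b ℚ.+ sum S                  ≡⟨ cong (weight b ℚ.+_) (trans (sym (measure≡sum S)) (measure-unit S)) ⟩
  weight b ℚ.+ ℕ→ℚ ∣ S ∣              ≡⟨ count b ⟩
  ℕ→ℚ ∣ b ∷ S ∣                       ∎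
  where
  open ≡-Reasoning
  weight : Bool → ℚ
  weight b = if b then 1ℚ else 0ℚ
  sum : Subset m′ → ℚ
  sum S = List.foldr ℚ._+_ 0ℚ (List.tabulate λ u → weight (Vec.lookup S u))
  measure≡sum : (S : Subset m′) → measure (λ _ → 1ℚ) S ≡ sum S
  measure≡sum S = cong (List.foldr ℚ._+_ 0ℚ) (ListP.map-tabulate (λ u → u) (λ u → weight (Vec.lookup S u)))
  count : ∀ b → weight b ℚ.+ ℕ→ℚ ∣ S ∣ ≡ ℕ→ℚ ∣ b ∷ S ∣
  count true  = sym (ℕ→ℚ-homo-+ 1 ∣ S ∣)
  count false = ℚP.+-identityˡ (ℕ→ℚ ∣ S ∣)

unitCoverage : (Fin n → Subset m) → Coverage n
unitCoverage {m = m} A = record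
  { m = m ; A = A ; w = λ _ → 1ℚ ; w-nonneg = λ _ → ℚP.nonNegative⁻¹ 1ℚ }

eval-unitCoverage : (A : Fin n → Subset m) (T : Subset n) →
                    Coverage.eval (unitCoverage A) T ≡ ℕ→ℚ ∣ bigUnion A T ∣
eval-unitCoverage A T = measure-unit (bigUnion A T)

foldr-⊔-upperBound : {x : ℕ} {xs : List ℕ} → x List.∈ xs → x ≤ List.foldr _⊔_ 0 xs
foldr-⊔-upperBound {xs = y List.∷ ys} (hereₗ refl)  = ℕP.m≤m⊔n y _
foldr-⊔-upperBound {xs = y List.∷ ys} (thereₗ x∈ys) =
  ℕP.≤-trans (foldr-⊔-upperBound x∈ys) (ℕP.m≤n⊔m y _)

∈-allSubsets : (S : Subset n) → S List.∈ allSubsets n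
∈-allSubsets []                    = hereₗ refl
∈-allSubsets {suc n} (inside ∷ S)  = ListMem.∈-++⁺ˡ (ListMem.∈-map⁺ (inside ∷_) (∈-allSubsets S))
∈-allSubsets {suc n} (outside ∷ S) =
  ListMem.∈-++⁺ʳ (List.map (inside ∷_) (allSubsets n)) (ListMem.∈-map⁺ (outside ∷_) (∈-allSubsets S))

module MatroidRank (M : Matroid n) where
  open Matroid M

  private
    rk : Subset n → ℕ
    rk = rank M

    indepIn? : (T S : Subset n) → Dec (S ⊆ T × Indep S)
    indepIn? T S = (S ⊆? T) ×-dec indep? S

  MaxIndep : Subset n → Subset n → Set
  MaxIndep T S = S ⊆ T × Indep S × ∣ S ∣ ≡ rk T

  indep⇒∣∣≤rank : ∀ {S T} → S ⊆ T → Indep S → ∣ S ∣ ≤ rk T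
  indep⇒∣∣≤rank {S} {T} S⊆T S-indep = foldr-⊔-upperBound
    (ListMem.∈-map⁺ ∣_∣ (ListMem.∈-filter⁺ (indepIn? T) (∈-allSubsets S) (S⊆T , S-indep)))

  maxIndep : ∀ T → ∃ (MaxIndep T)
  maxIndep T with ListMem.foldr-selective ℕP.⊔-sel 0
                   (List.map ∣_∣ (filter (indepIn? T) (allSubsets n)))
  ... | inj₁ rank≡0 = ⊥ , ⊆-min T , indep-⊥ , trans (∣⊥∣≡0 n) (sym rank≡0)
  ... | inj₂ rank∈ with ListMem.∈-map⁻ ∣_∣ rank∈
  ...   | S , S∈ , rank≡∣S∣ with ListMem.∈-filter⁻ (indepIn? T) {xs = allSubsets n} S∈
  ...     | _ , S⊆T , S-indep = S , S⊆T , S-indep , sym rank≡∣S∣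

  rank-mono : ∀ {P Q} → P ⊆ Q → rk P ≤ rk Q
  rank-mono P⊆Q with maxIndep _
  ... | S , S⊆P , S-indep , ∣S∣≡rank = subst (_≤ _) ∣S∣≡rank (indep⇒∣∣≤rank (⊆-trans S⊆P P⊆Q) S-indep)

  rank≤∣∣ : ∀ T → rk T ≤ ∣ T ∣
  rank≤∣∣ T with maxIndep T
  ... | S , S⊆T , _ , ∣S∣≡rank = subst (_≤ _) ∣S∣≡rank (p⊆q⇒∣p∣≤∣q∣ S⊆T)

  indep-extend : ∀ {I T} → I ⊆ T → Indep I → ∃ λ J → I ⊆ J × MaxIndep T J
  indep-extend {I} {T} I⊆T I-indep =
    go (rk T ∸ ∣ I ∣) I⊆T I-indep (ℕP.m∸n+n≡m (indep⇒∣∣≤rank I⊆T I-indep))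
    where
    go : ∀ k {I} → I ⊆ T → Indep I → k + ∣ I ∣ ≡ rk T → ∃ λ J → I ⊆ J × MaxIndep T J
    go zero    {I} I⊆T I-indep ∣I∣≡rank = I , ⊆-refl , I⊆T , I-indep , ∣I∣≡rank
    go (suc k) {I} I⊆T I-indep k+1+∣I∣≡rank with maxIndep T
    ... | S , S⊆T , S-indep , ∣S∣≡rank
      with exchange I-indep S-indep (ℕP.≤-trans (s≤s (ℕP.m≤n+m ∣ I ∣ k))
                                                (ℕP.≤-reflexive (trans k+1+∣I∣≡rank (sym ∣S∣≡rank))))
    ... | x , x∈S , x∉I , I+x-indep
      with go k (∪-⊆ I⊆T (x∈p⇒⁅x⁆⊆p (S⊆T x∈S))) I+x-indep
              (trans (cong (k +_) (x∉p⇒∣p∪⁅x⁆∣≡1+∣p∣ I x x∉I)) (trans (ℕP.+-suc k ∣ I ∣) k+1+∣I∣≡rank))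
    ... | J , I+x⊆J , J-max = J , ⊆-trans (p⊆p∪q ⁅ x ⁆) I+x⊆J , J-max

  rank-submodular : ∀ P Q → rk (P ∪ Q) + rk (P ∩ Q) ≤ rk P + rk Q
  rank-submodular P Q with maxIndep (P ∩ Q)
  ... | B , B⊆P∩Q , B-indep , ∣B∣≡rank
    with indep-extend (⊆-trans B⊆P∩Q (⊆-trans (p∩q⊆p P Q) (p⊆p∪q Q))) B-indep
  ... | J , B⊆J , J⊆P∪Q , J-indep , ∣J∣≡rank = begin
    rk (P ∪ Q) + rk (P ∩ Q)   ≡⟨ cong₂ _+_ ∣J∣≡rank ∣B∣≡rank ⟨
    ∣ J ∣ + ∣ B ∣             ≤⟨ ℕP.+-mono-≤ (p⊆q⇒∣p∣≤∣q∣ J⊆JP∪JQ) (p⊆q⇒∣p∣≤∣q∣ B⊆JP∩JQ) ⟩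
    ∣ JP ∪ JQ ∣ + ∣ JP ∩ JQ ∣ ≡⟨ ∣p∪q∣+∣p∩q∣≡∣p∣+∣q∣ JP JQ ⟩
    ∣ JP ∣ + ∣ JQ ∣           ≤⟨ ℕP.+-mono-≤ (indep⇒∣∣≤rank (p∩q⊆q J P) (indep-⊆ (p∩q⊆p J P) J-indep))
                                             (indep⇒∣∣≤rank (p∩q⊆q J Q) (indep-⊆ (p∩q⊆p J Q) J-indep)) ⟩
    rk P + rk Q               ∎
    where
    open ℕP.≤-Reasoning
    JP JQ : Subset n
    JP = J ∩ P
    JQ = J ∩ Q
    J⊆JP∪JQ : J ⊆ JP ∪ JQ
    J⊆JP∪JQ x∈J with x∈p∪q⁻ P Q (J⊆P∪Q x∈J)
    ... | inj₁ x∈P = p⊆p∪q JQ (x∈p∩q⁺ (x∈J , x∈P))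
    ... | inj₂ x∈Q = q⊆p∪q JP JQ (x∈p∩q⁺ (x∈J , x∈Q))
    B⊆JP∩JQ : B ⊆ JP ∩ JQ
    B⊆JP∩JQ = ⊆-∩ (⊆-∩ B⊆J (⊆-trans B⊆P∩Q (p∩q⊆p P Q))) (⊆-∩ B⊆J (⊆-trans B⊆P∩Q (p∩q⊆q P Q)))

  rank-submodular-∪ : ∀ P Q X → rk ((P ∪ Q) ∪ X) + rk X ≤ rk (P ∪ X) + rk (Q ∪ X)
  rank-submodular-∪ P Q X = begin
    rk ((P ∪ Q) ∪ X) + rk X                 ≤⟨ ℕP.+-mono-≤ (ℕP.≤-reflexive (cong rk (union P Q X)))
                                                            (rank-mono (⊆-∩ (q⊆p∪q P X) (q⊆p∪q Q X))) ⟩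
    rk ((P ∪ X) ∪ (Q ∪ X)) + rk ((P ∪ X) ∩ (Q ∪ X)) ≤⟨ rank-submodular (P ∪ X) (Q ∪ X) ⟩
    rk (P ∪ X) + rk (Q ∪ X)                 ∎
    where
    open ℕP.≤-Reasoning
    open ICMSolver (∪-idempotentCommutativeMonoid n)
    union : ∀ P Q X → (P ∪ Q) ∪ X ≡ (P ∪ X) ∪ (Q ∪ X)
    union = solve 3 (λ P Q X → (P ⊕ Q) ⊕ X ⊜ (P ⊕ X) ⊕ (Q ⊕ X)) refl

  rank-⁅x⁆∪ : ∀ x X → rk (⁅ x ⁆ ∪ X) ≤ suc (rk X)
  rank-⁅x⁆∪ x X = begin
    rk (⁅ x ⁆ ∪ X)                      ≤⟨ ℕP.m≤m+n _ _ ⟩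
    rk (⁅ x ⁆ ∪ X) + rk (⁅ x ⁆ ∩ X)     ≤⟨ rank-submodular ⁅ x ⁆ X ⟩
    rk ⁅ x ⁆ + rk X                     ≤⟨ ℕP.+-monoˡ-≤ (rk X) (ℕP.≤-trans (rank≤∣∣ ⁅ x ⁆) (ℕP.≤-reflexive (∣⁅x⁆∣≡1 x))) ⟩
    suc (rk X)                          ∎
    where open ℕP.≤-Reasoning

fromMaybe-head-∈ : ∀ {A : Set} {x : A} {xs} d → x List.∈ xs → fromMaybe d (List.head xs) List.∈ xs
fromMaybe-head-∈ d (hereₗ _)  = hereₗ refl
fromMaybe-head-∈ d (thereₗ _) = hereₗ refl

fromMaybe-head-irrelevant : ∀ {A : Set} {x : A} {xs} d e → x List.∈ xs →
                            fromMaybe d (List.head xs) ≡ fromMaybe e (List.head xs)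
fromMaybe-head-irrelevant d e (hereₗ _)  = refl
fromMaybe-head-irrelevant d e (thereₗ _) = refl

module Representative {_∼_ : Rel (Fin n) 0ℓ} (∼-isPER : IsPartialEquivalence _∼_)
                      (_∼?_ : Decidable _∼_) where
  open IsPartialEquivalence ∼-isPER renaming (sym to ∼-sym; trans to ∼-trans)

  class : Fin n → List (Fin n)
  class i = filter (i ∼?_) (allFin n)

  ∈-class : ∀ {i} → i ∼ i → i List.∈ class i
  ∈-class {i} i∼i = ListMem.∈-filter⁺ (i ∼?_) (ListMem.∈-allFin i) i∼i

  rep : Fin n → Fin n
  rep i = fromMaybe i (List.head (class i))

  ∼-rep : ∀ {i} → i ∼ i → i ∼ rep i
  ∼-rep {i} i∼i = proj₂ (ListMem.∈-filter⁻ (i ∼?_) {xs = allFin n} (fromMaybe-head-∈ i (∈-class i∼i)))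

  rep-cong : ∀ {i j} → i ∼ j → rep i ≡ rep j
  rep-cong {i} {j} i∼j = begin
    fromMaybe i (List.head (class i)) ≡⟨ fromMaybe-head-irrelevant i j (∈-class (∼-trans i∼j (∼-sym i∼j))) ⟩
    fromMaybe j (List.head (class i)) ≡⟨ cong (fromMaybe j ∘ List.head) same-class ⟩
    fromMaybe j (List.head (class j)) ∎
    where
    open ≡-Reasoning
    same-class : class i ≡ class j
    same-class = ListP.filter-≐ (i ∼?_) (j ∼?_) (∼-trans (∼-sym i∼j) , ∼-trans i∼j) (allFin n)

  rep-injective : ∀ {i j} → i ∼ i → j ∼ j → rep i ≡ rep j → i ∼ j
  rep-injective {i} {j} i∼i j∼j repi≡repj =
    ∼-trans (∼-rep i∼i) (∼-sym (subst (j ∼_) (sym repi≡repj) (∼-rep j∼j)))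

-- Rank above τ: ρ T ∸ r₀ is the rank function of the contraction M / τ

module Contraction (M : Matroid n) (τ : Subset n) where
  open MatroidRank M

  ρ : Subset n → ℕ
  ρ T = rank M (T ∪ τ)

  r₀ : ℕ
  r₀ = rank M τ

  ρ-mono-∪ : ∀ P Q → ρ P ≤ ρ (P ∪ Q)
  ρ-mono-∪ P Q = rank-mono (∪-⊆ (⊆-trans (p⊆p∪q Q) (p⊆p∪q τ)) (q⊆p∪q (P ∪ Q) τ))

  ρ-∪-comm : ∀ P Q → ρ (P ∪ Q) ≡ ρ (Q ∪ P)
  ρ-∪-comm P Q = cong ρ (∪-comm P Q)

  ρ-pair≤ : ∀ i j → ρ (⁅ i ⁆ ∪ ⁅ j ⁆) + r₀ ≤ ρ ⁅ i ⁆ + ρ ⁅ j ⁆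
  ρ-pair≤ i j = rank-submodular-∪ ⁅ i ⁆ ⁅ j ⁆ τ

  Nonloop : Fin n → Set
  Nonloop i = ρ ⁅ i ⁆ ≡ suc r₀

  nonloop? : ∀ i → Dec (Nonloop i)
  nonloop? i = ρ ⁅ i ⁆ ℕ.≟ suc r₀

  ρ-loop : ∀ {i} → ¬ Nonloop i → ρ ⁅ i ⁆ ≡ r₀
  ρ-loop {i} ¬nl = ℕP.≤-antisym (ℕP.≤-pred (ℕP.≤∧≢⇒< (rank-⁅x⁆∪ i τ) ¬nl)) (rank-mono (q⊆p∪q ⁅ i ⁆ τ))

  ρ-pair-loopˡ : ∀ {i} j → ¬ Nonloop i → ρ (⁅ i ⁆ ∪ ⁅ j ⁆) ≡ ρ ⁅ j ⁆
  ρ-pair-loopˡ {i} j ¬nl = ℕP.≤-antisym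
    (ℕP.+-cancelʳ-≤ r₀ _ _ (ℕP.≤-trans (ρ-pair≤ i j)
      (ℕP.≤-reflexive (trans (cong (_+ ρ ⁅ j ⁆) (ρ-loop ¬nl)) (ℕP.+-comm r₀ _)))))
    (ℕP.≤-trans (ρ-mono-∪ ⁅ j ⁆ ⁅ i ⁆) (ℕP.≤-reflexive (ρ-∪-comm ⁅ j ⁆ ⁅ i ⁆)))

  ρ-pair-loopʳ : ∀ i {j} → ¬ Nonloop j → ρ (⁅ i ⁆ ∪ ⁅ j ⁆) ≡ ρ ⁅ i ⁆
  ρ-pair-loopʳ i ¬nl = trans (ρ-∪-comm ⁅ i ⁆ _) (ρ-pair-loopˡ i ¬nl)

  Parallel : Rel (Fin n) 0ℓ
  Parallel i j = Nonloop i × Nonloop j × ρ (⁅ i ⁆ ∪ ⁅ j ⁆) ≡ suc r₀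

  parallel? : Decidable Parallel
  parallel? i j = nonloop? i ×-dec nonloop? j ×-dec ρ (⁅ i ⁆ ∪ ⁅ j ⁆) ℕ.≟ suc r₀

  parallel-refl : ∀ {i} → Nonloop i → Parallel i i
  parallel-refl {i} nl = nl , nl , trans (cong ρ (∪-idem ⁅ i ⁆)) nl

  parallel-sym : ∀ {i j} → Parallel i j → Parallel j i
  parallel-sym {i} {j} (nlᵢ , nlⱼ , ρij) = nlⱼ , nlᵢ , trans (ρ-∪-comm ⁅ j ⁆ ⁅ i ⁆) ρij

  parallel-trans : ∀ {i j k} → Parallel i j → Parallel j k → Parallel i k
  parallel-trans {i} {j} {k} (nlᵢ , nlⱼ , ρij) (_ , nlₖ , ρjk) = nlᵢ , nlₖ , ℕP.≤-antisym
    (ℕP.+-cancelʳ-≤ (suc r₀) _ _ (begin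
      ρ (⁅ i ⁆ ∪ ⁅ k ⁆) + suc r₀
        ≤⟨ ℕP.+-mono-≤ (ρ-mono-∪ (⁅ i ⁆ ∪ ⁅ k ⁆) ⁅ j ⁆) (ℕP.≤-reflexive (sym nlⱼ)) ⟩
      ρ ((⁅ i ⁆ ∪ ⁅ k ⁆) ∪ ⁅ j ⁆) + ρ ⁅ j ⁆
        ≡⟨ cong (λ S → rank M S + ρ ⁅ j ⁆) (∪-assoc (⁅ i ⁆ ∪ ⁅ k ⁆) ⁅ j ⁆ τ) ⟩
      rank M ((⁅ i ⁆ ∪ ⁅ k ⁆) ∪ (⁅ j ⁆ ∪ τ)) + rank M (⁅ j ⁆ ∪ τ)
        ≤⟨ rank-submodular-∪ ⁅ i ⁆ ⁅ k ⁆ (⁅ j ⁆ ∪ τ) ⟩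
      rank M (⁅ i ⁆ ∪ (⁅ j ⁆ ∪ τ)) + rank M (⁅ k ⁆ ∪ (⁅ j ⁆ ∪ τ))
        ≡⟨ cong₂ (λ S T → rank M S + rank M T) (∪-assoc ⁅ i ⁆ ⁅ j ⁆ τ) (∪-assoc ⁅ k ⁆ ⁅ j ⁆ τ) ⟨
      ρ (⁅ i ⁆ ∪ ⁅ j ⁆) + ρ (⁅ k ⁆ ∪ ⁅ j ⁆)
        ≡⟨ cong₂ _+_ ρij (trans (ρ-∪-comm ⁅ k ⁆ ⁅ j ⁆) ρjk) ⟩
      suc r₀ + suc r₀ ∎))
    (subst (_≤ ρ (⁅ i ⁆ ∪ ⁅ k ⁆)) nlᵢ (ρ-mono-∪ ⁅ i ⁆ ⁅ k ⁆))
    where open ℕP.≤-Reasoning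

  parallel-isPartialEquivalence : IsPartialEquivalence Parallel
  parallel-isPartialEquivalence = record { sym = parallel-sym ; trans = parallel-trans }

  ρ-nonparallel : ∀ {i j} → Nonloop i → Nonloop j → ¬ Parallel i j → ρ (⁅ i ⁆ ∪ ⁅ j ⁆) ≡ 2 + r₀
  ρ-nonparallel {i} {j} nlᵢ nlⱼ ¬par = ℕP.≤-antisym
    (ℕP.+-cancelʳ-≤ r₀ _ _ (ℕP.≤-trans (ρ-pair≤ i j)
      (ℕP.≤-reflexive (trans (cong₂ _+_ nlᵢ nlⱼ) (ℕP.+-suc (suc r₀) r₀)))))
    (ℕP.≤∧≢⇒< (subst (_≤ ρ (⁅ i ⁆ ∪ ⁅ j ⁆)) nlᵢ (ρ-mono-∪ ⁅ i ⁆ ⁅ j ⁆)) (λ ρ≡ → ¬par (nlᵢ , nlⱼ , sym ρ≡)))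

  open Representative parallel-isPartialEquivalence parallel?

  A : Fin n → Subset n
  A i = if does (nonloop? i) then ⁅ rep i ⁆ else ⊥

  A-nonloop : ∀ {i} → Nonloop i → A i ≡ ⁅ rep i ⁆
  A-nonloop {i} nl = cong (if_then ⁅ rep i ⁆ else ⊥) (dec-true (nonloop? i) nl)

  A-loop : ∀ {i} → ¬ Nonloop i → A i ≡ ⊥
  A-loop {i} ¬nl = cong (if_then ⁅ rep i ⁆ else ⊥) (dec-false (nonloop? i) ¬nl)

  ρ-⁅⁆ : ∀ i → ρ ⁅ i ⁆ ≡ ∣ A i ∣ + r₀
  ρ-⁅⁆ i = by-cases (nonloop? i)
    where
    by-cases : Dec (Nonloop i) → ρ ⁅ i ⁆ ≡ ∣ A i ∣ + r₀
    by-cases (yes nl)  = trans nl (cong (_+ r₀) (sym (trans (cong ∣_∣ (A-nonloop nl)) (∣⁅x⁆∣≡1 (rep i)))))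
    by-cases (no  ¬nl) = trans (ρ-loop ¬nl) (cong (_+ r₀) (sym (trans (cong ∣_∣ (A-loop ¬nl)) (∣⊥∣≡0 n))))

  ρ-nonloops : ∀ {i j} → Nonloop i → Nonloop j → ρ (⁅ i ⁆ ∪ ⁅ j ⁆) ≡ ∣ ⁅ rep i ⁆ ∪ ⁅ rep j ⁆ ∣ + r₀
  ρ-nonloops {i} {j} nlᵢ nlⱼ = by-cases (parallel? i j)
    where
    by-cases : Dec (Parallel i j) → ρ (⁅ i ⁆ ∪ ⁅ j ⁆) ≡ ∣ ⁅ rep i ⁆ ∪ ⁅ rep j ⁆ ∣ + r₀
    by-cases (yes par)  = trans (proj₂ (proj₂ par)) (cong (_+ r₀) (sym
      (trans (cong (λ x → ∣ ⁅ x ⁆ ∪ ⁅ rep j ⁆ ∣) (rep-cong par)) (∣⁅x⁆∪⁅x⁆∣≡1 (rep j)))))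
    by-cases (no  ¬par) = trans (ρ-nonparallel nlᵢ nlⱼ ¬par) (cong (_+ r₀) (sym
      (x≢y⇒∣⁅x⁆∪⁅y⁆∣≡2 (¬par ∘ rep-injective (parallel-refl nlᵢ) (parallel-refl nlⱼ)))))

  ρ-⁅⁆∪⁅⁆ : ∀ i j → ρ (⁅ i ⁆ ∪ ⁅ j ⁆) ≡ ∣ A i ∪ A j ∣ + r₀
  ρ-⁅⁆∪⁅⁆ i j = by-cases (nonloop? i) (nonloop? j)
    where
    size-cong : ∀ {S} → A i ∪ A j ≡ S → ∣ A i ∪ A j ∣ + r₀ ≡ ∣ S ∣ + r₀
    size-cong = cong (λ S → ∣ S ∣ + r₀)
    by-cases : Dec (Nonloop i) → Dec (Nonloop j) → ρ (⁅ i ⁆ ∪ ⁅ j ⁆) ≡ ∣ A i ∪ A j ∣ + r₀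
    by-cases (no ¬nlᵢ) _         = trans (ρ-pair-loopˡ j ¬nlᵢ) (trans (ρ-⁅⁆ j)
      (sym (size-cong (trans (cong (_∪ A j) (A-loop ¬nlᵢ)) (∪-identityˡ (A j))))))
    by-cases _         (no ¬nlⱼ) = trans (ρ-pair-loopʳ i ¬nlⱼ) (trans (ρ-⁅⁆ i)
      (sym (size-cong (trans (cong (A i ∪_) (A-loop ¬nlⱼ)) (∪-identityʳ (A i))))))
    by-cases (yes nlᵢ) (yes nlⱼ) = trans (ρ-nonloops nlᵢ nlⱼ)
      (sym (size-cong (cong₂ _∪_ (A-nonloop nlᵢ) (A-nonloop nlⱼ))))

  ρ≡∣bigUnion∣+r₀ : ∀ T → ∣ T ∣ ≡ 1 ⊎ ∣ T ∣ ≡ 2 → ρ T ≡ ∣ bigUnion A T ∣ + r₀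
  ρ≡∣bigUnion∣+r₀ T (inj₁ ∣T∣≡1) with ∣p∣≡1⇒p≡⁅x⁆ T ∣T∣≡1
  ... | i , refl = trans (ρ-⁅⁆ i) (cong (λ S → ∣ S ∣ + r₀) (sym (bigUnion-⁅⁆ A i)))
  ρ≡∣bigUnion∣+r₀ T (inj₂ ∣T∣≡2) with ∣p∣≡2⇒p≡⁅x⁆∪⁅y⁆ T ∣T∣≡2
  ... | i , j , refl = trans (ρ-⁅⁆∪⁅⁆ i j) (cong (λ S → ∣ S ∣ + r₀) (sym (begin
    bigUnion A (⁅ i ⁆ ∪ ⁅ j ⁆)           ≡⟨ bigUnion-∪ A ⁅ i ⁆ ⁅ j ⁆ ⟩
    bigUnion A ⁅ i ⁆ ∪ bigUnion A ⁅ j ⁆  ≡⟨ cong₂ _∪_ (bigUnion-⁅⁆ A i) (bigUnion-⁅⁆ A j) ⟩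
    A i ∪ A j                            ∎)))
    where open ≡-Reasoning

mainTheorem8 : (n : ℕ) (M : Matroid n) → Strongly2Coverage (λ T → ℕ→ℚ (rank M T))
mainTheorem8 n M τ _ = unitCoverage A , λ T _ ∣T∣∈⦃1,2⦄ → begin
  ℕ→ℚ (rank M (T ∪ τ))                           ≡⟨ cong ℕ→ℚ (ρ≡∣bigUnion∣+r₀ T ∣T∣∈⦃1,2⦄) ⟩
  ℕ→ℚ (∣ bigUnion A T ∣ + r₀)                    ≡⟨ ℕ→ℚ-homo-+ ∣ bigUnion A T ∣ r₀ ⟩
  ℕ→ℚ ∣ bigUnion A T ∣ ℚ.+ ℕ→ℚ r₀                ≡⟨ cong (ℚ._+ ℕ→ℚ r₀) (eval-unitCoverage A T) ⟨
  Coverage.eval (unitCoverage A) T ℚ.+ ℕ→ℚ r₀    ∎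
  where
  open Contraction M τ
  open ≡-Reasoning
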